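{- Let $p$ and $q$ be two positive integers and $m=pq+\binom{p}{2}$ the number of edges of the complete split graph $\mathrm{SPK}_{p,q}$. Then $$\delta(\mathcal{A}(\mathrm{SPK}_{p,q}))\le 2pq+\binom{p}{2}=2m-\binom{p}{2}.$$
   Context: The complete split graph $\mathrm{SPK}_{p,q}$ has vertex set $P\cup Q$ with $|P|=p$, $|Q|=q$, where $P$ is a clique, $Q$ is an independent set, and every vertex of $P$ is adjacent to every vertex of $Q$. For a connected graph $G=(V,E)$, a search tree on $G$ is a rooted tree with vertex set $V$ whose root is some $r\in V$ joined to the roots of search trees on each connected component of $G-r$. The tubes of a search tree are the vertex sets of its subtrees; two search trees are related by a rotation if their tube sets have symmetric difference of size exactly two. The graph associahedron $\mathcal{A}(G)$ is a polytope whose skeleton is isomorphic to the graph on search trees of $G$ with adjacency given by rotations; $\delta(\mathcal{A}(G))$ is the diameter of this graph. -}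

module Defs where

open import Data.Nat using (ℕ; zero; suc; _+_; _*_; _<_; _≤_)
open import Data.Fin using (Fin; toℕ)
open import Data.Fin.Subset using (Subset; _∈_; _⊆_; Nonempty; _-_; _∪_; ⊥; ⊤)
open import Data.List using (List; foldr; map)
open import Data.List.Relation.Unary.All using (All)
open import Data.List.Relation.Unary.Any using (Any)
open import Data.List.Relation.Unary.AllPairs using (AllPairs)
open import Data.Product using (Σ; _×_; ∃; proj₁; proj₂)
open import Data.Sum using (_⊎_)
open import Relation.Binary.PropositionalEquality using (_≡_; _≢_)
open import Relation.Nullary using (¬_)

module GraphDefs {n : ℕ} (E : Fin n → Fin n → Set) where

  data Walk (S : Subset n) : Fin n → Fin n → Set where
    stay : ∀ {u} → u ∈ S → Walk S u u
    step : ∀ {u v w} → u ∈ S → E u v → Walk S v w → Walk S u w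

  Connected : Subset n → Set
  Connected S = ∀ u v → u ∈ S → v ∈ S → Walk S u v

  IsComponent : Subset n → Subset n → Set
  IsComponent S C =
    C ⊆ S × Nonempty C × Connected C ×
    (∀ u v → u ∈ C → v ∈ S → E u v → v ∈ C)

  ⋃L : List (Subset n) → Subset n
  ⋃L = foldr _∪_ ⊥

  data SearchTree (S : Subset n) : Set where
    node : (r : Fin n) → r ∈ S →
           (ch : List (Σ (Subset n) SearchTree)) →
           All (λ c → IsComponent (S - r) (proj₁ c)) ch →
           AllPairs (λ c d → proj₁ c ≢ proj₁ d) ch →
           ⋃L (map proj₁ ch) ≡ S - r →
           SearchTree S

  -- X is a tube of T, i.e. the vertex set of some subtree of T
  data IsTube : {S : Subset n} → SearchTree S → Subset n → Set where
    here  : ∀ {S r r∈S ch a p u} →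
            IsTube (node {S} r r∈S ch a p u) S
    there : ∀ {S r r∈S ch a p u X} →
            Any (λ c → IsTube (proj₂ c) X) ch →
            IsTube (node {S} r r∈S ch a p u) X

  InSymDiff : ∀ {S} → SearchTree S → SearchTree S → Subset n → Set
  InSymDiff T T' Z = (IsTube T Z × ¬ IsTube T' Z) ⊎ (¬ IsTube T Z × IsTube T' Z)

  Rotation : ∀ {S} → SearchTree S → SearchTree S → Set
  Rotation T T' = Σ (Subset n) λ X → Σ (Subset n) λ Y →
    X ≢ Y × InSymDiff T T' X × InSymDiff T T' Y ×
    (∀ Z → InSymDiff T T' Z → Z ≡ X ⊎ Z ≡ Y)

  -- two representations describe the same search tree (same tubes)
  SameTree : ∀ {S} → SearchTree S → SearchTree S → Set
  SameTree T T' = ∀ X → (IsTube T X → IsTube T' X) × (IsTube T' X → IsTube T X)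

  data RotPath {S : Subset n} : SearchTree S → SearchTree S → ℕ → Set where
    done : ∀ {T T'} → SameTree T T' → RotPath T T' zero
    next : ∀ {T U T' k} → Rotation T U → RotPath U T' k → RotPath T T' (suc k)

  -- diameter of the rotation graph (skeleton of A(G)) is at most d
  DiameterAtMost : ℕ → Set
  DiameterAtMost d = ∀ (T T' : SearchTree ⊤) → ∃ λ k → k ≤ d × RotPath T T' k

-- Complete split graph SPK_{p,q} on Fin (p + q):
-- vertices with index < p form the clique P, the others the
-- independent set Q.

InP : ∀ {p q} → Fin (p + q) → Set
InP {p} i = toℕ i < p

SPK-Adj : (p q : ℕ) → Fin (p + q) → Fin (p + q) → Set
SPK-Adj p q i j = i ≢ j × (InP {p} {q} i ⊎ InP {p} {q} j)

{-# OPTIONS --safe #-}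
-- Call a search tree of the complete split graph standard if no independent vertex lies above a
-- clique vertex: it is a path through the clique P with the vertices of Q hanging below as leaves.
-- A search tree on a vertex set S becomes standard after at most |S ∩ P| · |S ∩ Q| rotations:
-- standardize the subtree below the root and, if the root is independent, let it sink past the
-- clique vertices below it, one rotation for each. Two standard trees differ only in the order of
-- their clique paths, and bubble sort (raise the root of one to the top of the other at cost
-- |S ∩ P| - 1, then recurse below it) joins them by at most C(|S ∩ P|, 2) rotations.
-- Altogether the diameter is at most pq + C(p, 2) + pq.
module Submission where

open import Defs
open import Data.Nat using (ℕ; zero; suc; _+_; _*_; _∸_; _≤_; _<_; z≤n; s≤s; _<?_)
open import Data.Nat.Properties
  using (≤-refl; ≤-reflexive; ≤-trans; m≤m+n; n≤1+n; +-mono-≤; *-monoˡ-≤;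
         +-comm; +-assoc; +-identityʳ; *-assoc; *-suc; m+n∸m≡n; module ≤-Reasoning)
open import Data.Nat.Combinatorics using (_C_; nC1≡n; nCk+nC[k+1]≡[n+1]C[k+1])
open import Data.Fin using (Fin; toℕ; zero; suc; _≟_; fromℕ<)
open import Data.Fin.Properties using (any?; toℕ-fromℕ<)
open import Data.Fin.Subset
  using (Subset; _∈_; _∉_; _⊆_; Nonempty; _-_; _─_; _∪_; _∩_; ∁; ⊥; ⊤; ⁅_⁆; inside; outside; ∣_∣)
open import Data.Fin.Subset.Properties
  using (_∈?_; ∈⊤; ∉⊥; x∈⁅x⁆; x∈⁅y⁆⇒x≡y; ⊆-antisym; x∈p∪q⁺; x∈p∪q⁻; x∈p∧x≢y⇒x∈p-y;
         x∈p⇒x∉∁p; x∉p⇒x∈∁p; p─⊥≡p; p─q⊆p; p─x─y≡p─y─x; ∪-identityʳ; ∩-identityˡ;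
         ∣⊥∣≡0; ∣∁p∣≡n∸∣p∣)
open import Data.Vec using (_∷_; here; there)
open import Data.List using (List; []; _∷_; map)
import Data.List.Relation.Unary.All as All
open import Data.List.Relation.Unary.All using (All; []; _∷_)
open import Data.List.Relation.Unary.Any using (Any; here; there)
open import Data.List.Relation.Unary.AllPairs using (AllPairs; []; _∷_)
open import Data.Product using (Σ; ∃; _×_; _,_; proj₁; proj₂)
open import Data.Sum using (_⊎_; inj₁; inj₂; [_,_]′)
open import Data.Unit using (tt) renaming (⊤ to Unit)
open import Data.Empty using (⊥-elim)
open import Function using (_∘_; id)
open import Relation.Binary.PropositionalEquality
open import Relation.Nullary using (¬_; Dec; yes; no)
open import Relation.Nullary.Decidable using (_×-dec_)

module _ where

  private variable
    m : ℕ
    x y : Fin m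
    p : Subset m

  x∈p─q⇒x∉q : ∀ (p q : Subset m) → x ∈ p ─ q → x ∉ q
  x∈p─q⇒x∉q (inside ∷ p) (outside ∷ q) here ()
  x∈p─q⇒x∉q (_ ∷ p) (_ ∷ q) (there x∈p─q) (there x∈q) = x∈p─q⇒x∉q p q x∈p─q x∈q

  x∈p-y⇒x≢y : x ∈ p - y → x ≢ y
  x∈p-y⇒x≢y {p = p} {y = y} x∈p-y refl = x∈p─q⇒x∉q p ⁅ y ⁆ x∈p-y (x∈⁅x⁆ y)

  x∉p-x : x ∉ p - x
  x∉p-x x∈p-x = x∈p-y⇒x≢y x∈p-x refl

  x∈p-y⇒x∈p : x ∈ p - y → x ∈ p
  x∈p-y⇒x∈p {p = p} {y = y} = p─q⊆p p ⁅ y ⁆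

  ∣p∩q∣≡1+∣p-x∩q∣ : ∀ (p q : Subset m) → x ∈ p → x ∈ q → ∣ p ∩ q ∣ ≡ suc ∣ (p - x) ∩ q ∣
  ∣p∩q∣≡1+∣p-x∩q∣ (inside ∷ p) (inside ∷ q) here here = cong (λ r → suc ∣ r ∩ q ∣) (sym (p─⊥≡p p))
  ∣p∩q∣≡1+∣p-x∩q∣ (inside ∷ p) (inside ∷ q) (there x∈p) (there x∈q) = cong suc (∣p∩q∣≡1+∣p-x∩q∣ p q x∈p x∈q)
  ∣p∩q∣≡1+∣p-x∩q∣ (inside ∷ p) (outside ∷ q) (there x∈p) (there x∈q) = ∣p∩q∣≡1+∣p-x∩q∣ p q x∈p x∈q
  ∣p∩q∣≡1+∣p-x∩q∣ (outside ∷ p) (_ ∷ q) (there x∈p) (there x∈q) = ∣p∩q∣≡1+∣p-x∩q∣ p q x∈p x∈q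

  ∣p∩q∣≡∣p-x∩q∣ : ∀ (p q : Subset m) → x ∉ q → ∣ p ∩ q ∣ ≡ ∣ (p - x) ∩ q ∣
  ∣p∩q∣≡∣p-x∩q∣ {x = zero} (_ ∷ p) (inside ∷ q) x∉q = ⊥-elim (x∉q here)
  ∣p∩q∣≡∣p-x∩q∣ {x = zero} (inside ∷ p) (outside ∷ q) _ = cong (λ r → ∣ r ∩ q ∣) (sym (p─⊥≡p p))
  ∣p∩q∣≡∣p-x∩q∣ {x = zero} (outside ∷ p) (outside ∷ q) _ = cong (λ r → ∣ r ∩ q ∣) (sym (p─⊥≡p p))
  ∣p∩q∣≡∣p-x∩q∣ {x = suc x} (inside ∷ p) (inside ∷ q) x∉q = cong suc (∣p∩q∣≡∣p-x∩q∣ p q (x∉q ∘ there))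
  ∣p∩q∣≡∣p-x∩q∣ {x = suc x} (inside ∷ p) (outside ∷ q) x∉q = ∣p∩q∣≡∣p-x∩q∣ p q (x∉q ∘ there)
  ∣p∩q∣≡∣p-x∩q∣ {x = suc x} (outside ∷ p) (_ ∷ q) x∉q = ∣p∩q∣≡∣p-x∩q∣ p q (x∉q ∘ there)

  initial : ∀ k {l} → Subset (k + l)
  initial zero = ⊥
  initial (suc k) = inside ∷ initial k

  x∈initial⁺ : ∀ k {l} {x : Fin (k + l)} → toℕ x < k → x ∈ initial k
  x∈initial⁺ (suc k) {x = zero} _ = here
  x∈initial⁺ (suc k) {x = suc x} (s≤s x<k) = there (x∈initial⁺ k x<k)

  x∈initial⁻ : ∀ k {l} {x : Fin (k + l)} → x ∈ initial k → toℕ x < k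
  x∈initial⁻ zero x∈⊥ = ⊥-elim (∉⊥ x∈⊥)
  x∈initial⁻ (suc k) {x = zero} here = s≤s z≤n
  x∈initial⁻ (suc k) {x = suc x} (there x∈) = s≤s (x∈initial⁻ k x∈)

  ∣initial∣≡ : ∀ k {l} → ∣ initial k {l} ∣ ≡ k
  ∣initial∣≡ zero {l} = ∣⊥∣≡0 l
  ∣initial∣≡ (suc k) = cong suc (∣initial∣≡ k)

  n+nC2≡[1+n]C2 : ∀ n → n + n C 2 ≡ suc n C 2
  n+nC2≡[1+n]C2 n = trans (cong (_+ n C 2) (sym (nC1≡n n))) (nCk+nC[k+1]≡[n+1]C[k+1] n 1)

module SearchTreeProperties {n : ℕ} (E : Fin n → Fin n → Set) where

  open GraphDefs E

  private variable
    R S K : Subset n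
    r u v w : Fin n

  walk-source∈ : Walk S u v → u ∈ S
  walk-source∈ (stay u∈S) = u∈S
  walk-source∈ (step u∈S _ _) = u∈S

  walk-++ : Walk S u v → Walk S v w → Walk S u w
  walk-++ (stay _) w = w
  walk-++ (step u∈S e w₁) w₂ = step u∈S e (walk-++ w₁ w₂)

  walk-closed : (∀ u v → u ∈ K → v ∈ S → E u v → v ∈ K) → u ∈ K → Walk S u v → v ∈ K
  walk-closed closed u∈K (stay _) = u∈K
  walk-closed closed u∈K (step _ e w) = walk-closed closed (closed _ _ u∈K (walk-source∈ w) e) w

  connected⇒component≡ : Connected S → IsComponent S K → K ≡ S
  connected⇒component≡ conn (K⊆S , (c , c∈K) , _ , closed) =
    ⊆-antisym K⊆S (λ v∈S → walk-closed closed c∈K (conn _ _ (K⊆S c∈K) v∈S))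

  connected⇒component : Nonempty S → Connected S → IsComponent S S
  connected⇒component ne conn = id , ne , conn , λ _ _ _ v∈S _ → v∈S

  Children : Set
  Children = List (Σ (Subset n) SearchTree)

  AreComponents : Subset n → Children → Set
  AreComponents R ch = All (λ c → IsComponent R (proj₁ c)) ch

  Distinct : Children → Set
  Distinct ch = AllPairs (λ c d → proj₁ c ≢ proj₁ d) ch

  sole-child≡ : K ∪ ⊥ ≡ R → K ≡ R
  sole-child≡ {K} u = trans (sym (∪-identityʳ K)) u

  data SoleChild (R : Subset n) : (ch : Children) → AreComponents R ch → Distinct ch → Set where
    sole : ∀ {T ac} → SoleChild R ((R , T) ∷ []) (ac ∷ []) ([] ∷ [])

  sole-child : Nonempty R → Connected R → (ch : Children) (a : AreComponents R ch) (ap : Distinct ch) →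
               ⋃L (map proj₁ ch) ≡ R → SoleChild R ch a ap
  sole-child (v , v∈R) conn [] [] [] ⊥≡R = ⊥-elim (∉⊥ (subst (v ∈_) (sym ⊥≡R) v∈R))
  sole-child ne conn (_ ∷ []) (_ ∷ []) ([] ∷ []) u with sole-child≡ u
  ... | refl = sole
  sole-child ne conn (_ ∷ _ ∷ _) (ac ∷ ad ∷ _) ((K≢D ∷ _) ∷ _) _ =
    ⊥-elim (K≢D (trans (connected⇒component≡ conn ac) (sym (connected⇒component≡ conn ad))))

  AnyTube : Children → Subset n → Set
  AnyTube ch Z = Any (λ c → IsTube (proj₂ c) Z) ch

  mutual
    tube⊆ : ∀ {Z} (T : SearchTree S) → IsTube T Z → Z ⊆ S
    tube⊆ (node r r∈ ch a ap u) here = id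
    tube⊆ (node r r∈ ch a ap u) (there t) = x∈p-y⇒x∈p ∘ anyTube⊆ ch a t

    anyTube⊆ : ∀ {Z} (ch : Children) → AreComponents R ch → AnyTube ch Z → Z ⊆ R
    anyTube⊆ ((K , T) ∷ ch) (ac ∷ a) (here t) = proj₁ ac ∘ tube⊆ T t
    anyTube⊆ (_ ∷ ch) (_ ∷ a) (there t) = anyTube⊆ ch a t

  mutual
    tube-nonempty : ∀ {Z} (T : SearchTree S) → IsTube T Z → Nonempty Z
    tube-nonempty (node r r∈ ch a ap u) here = r , r∈
    tube-nonempty (node r r∈ ch a ap u) (there t) = anyTube-nonempty ch t

    anyTube-nonempty : ∀ {Z} (ch : Children) → AnyTube ch Z → Nonempty Z
    anyTube-nonempty ((K , T) ∷ ch) (here t) = tube-nonempty T t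
    anyTube-nonempty (_ ∷ ch) (there t) = anyTube-nonempty ch t

  tube-self : (T : SearchTree S) → IsTube T S
  tube-self (node r r∈ ch a ap u) = here

  node-tube⁻ : ∀ {r r∈ ch a ap u Z} → IsTube (node {S} r r∈ ch a ap u) Z → Z ≡ S ⊎ AnyTube ch Z
  node-tube⁻ here = inj₁ refl
  node-tube⁻ (there t) = inj₂ t

  single : r ∈ S → IsComponent (S - r) K → K ∪ ⊥ ≡ S - r → SearchTree K → SearchTree S
  single {r} r∈S ac u T = node r r∈S ((_ , T) ∷ []) (ac ∷ []) ([] ∷ []) u

  single-tube⁻ : ∀ {r∈S ac u Z} {T : SearchTree K} → IsTube (single {r} {S} r∈S ac u T) Z → Z ≡ S ⊎ IsTube T Z
  single-tube⁻ here = inj₁ refl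
  single-tube⁻ (there (here t)) = inj₂ t

  private variable
    T U W T' : SearchTree S
    k l : ℕ

  same-refl : SameTree T T
  same-refl X = id , id

  same-sym : SameTree T U → SameTree U T
  same-sym s X = proj₂ (s X) , proj₁ (s X)

  same-trans : SameTree T U → SameTree U W → SameTree T W
  same-trans s s' X = proj₁ (s' X) ∘ proj₁ (s X) , proj₂ (s X) ∘ proj₂ (s' X)

  single-same : ∀ {r∈S r∈S' ac ac' u u'} {T : SearchTree K} →
                SameTree (single {r} {S} r∈S ac u T) (single r∈S' ac' u' T)
  single-same X = move , move
    where
    move : ∀ {r∈S r∈S' ac ac' u u'} → IsTube (single r∈S ac u _) X → IsTube (single r∈S' ac' u' _) X
    move t with single-tube⁻ t
    ... | inj₁ refl = here
    ... | inj₂ t' = there (here t')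

  symDiff-swap : ∀ {Z} → InSymDiff T U Z → InSymDiff U T Z
  symDiff-swap (inj₁ (t , ¬u)) = inj₂ (¬u , t)
  symDiff-swap (inj₂ (¬t , u)) = inj₁ (u , ¬t)

  symDiff-congˡ : ∀ {Z} → SameTree T T' → InSymDiff T' U Z → InSymDiff T U Z
  symDiff-congˡ s (inj₁ (t , ¬u)) = inj₁ (proj₂ (s _) t , ¬u)
  symDiff-congˡ s (inj₂ (¬t , u)) = inj₂ (¬t ∘ proj₁ (s _) , u)

  rotation-sym : Rotation T U → Rotation U T
  rotation-sym (X , Y , X≢Y , dX , dY , only) =
    X , Y , X≢Y , symDiff-swap dX , symDiff-swap dY , λ Z → only Z ∘ symDiff-swap

  rotation-congˡ : SameTree T T' → Rotation T' U → Rotation T U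
  rotation-congˡ s (X , Y , X≢Y , dX , dY , only) =
    X , Y , X≢Y , symDiff-congˡ s dX , symDiff-congˡ s dY , λ Z → only Z ∘ symDiff-congˡ (same-sym s)

  rotation-by-exchange : (X Y : Subset n) → X ≢ Y →
    IsTube T X → ¬ IsTube U X → IsTube U Y → ¬ IsTube T Y →
    (∀ {Z} → IsTube T Z → Z ≡ X ⊎ IsTube U Z) → (∀ {Z} → IsTube U Z → Z ≡ Y ⊎ IsTube T Z) →
    Rotation T U
  rotation-by-exchange X Y X≢Y tX ¬uX uY ¬tY fromT fromU =
    X , Y , X≢Y , inj₁ (tX , ¬uX) , inj₂ (¬tY , uY) , only
    where
    only : ∀ Z → InSymDiff _ _ Z → Z ≡ X ⊎ Z ≡ Y
    only Z (inj₁ (t , ¬u)) = [ inj₁ , ⊥-elim ∘ ¬u ]′ (fromT t)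
    only Z (inj₂ (¬t , u)) = [ inj₂ , ⊥-elim ∘ ¬t ]′ (fromU u)

  path-congˡ : SameTree T T' → RotPath T' U k → RotPath T U k
  path-congˡ s (done s') = done (same-trans s s')
  path-congˡ s (next ρ π) = next (rotation-congˡ s ρ) π

  path-congʳ : RotPath T U k → SameTree U W → RotPath T W k
  path-congʳ (done s') s = done (same-trans s' s)
  path-congʳ (next ρ π) s = next ρ (path-congʳ π s)

  path-++ : RotPath T U k → RotPath U W l → RotPath T W (k + l)
  path-++ (done s) π = path-congˡ s π
  path-++ (next ρ π) π' = next ρ (path-++ π π')

  path-reverse : RotPath T U k → RotPath U T k
  path-reverse (done s) = done (same-sym s)
  path-reverse {k = suc k} (next ρ π) =
    subst (RotPath _ _) (+-comm k 1) (path-++ (path-reverse π) (next (rotation-sym ρ) (done same-refl)))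

  Dist≤ : SearchTree S → SearchTree S → ℕ → Set
  Dist≤ T U k = Σ ℕ λ j → j ≤ k × RotPath T U j

  dist-trans : Dist≤ T U k → Dist≤ U W l → Dist≤ T W (k + l)
  dist-trans (j , j≤k , π) (j' , j'≤l , π') = j + j' , +-mono-≤ j≤k j'≤l , path-++ π π'

  dist-sym : Dist≤ T U k → Dist≤ U T k
  dist-sym (j , j≤k , π) = j , j≤k , path-reverse π

  dist-mono : k ≤ l → Dist≤ T U k → Dist≤ T U l
  dist-mono k≤l (j , j≤k , π) = j , ≤-trans j≤k k≤l , π

  dist-congʳ : Dist≤ T U k → SameTree U W → Dist≤ T W k
  dist-congʳ (j , j≤k , π) s = j , j≤k , path-congʳ π s

  dist-same : SameTree T U → Dist≤ T U k
  dist-same s = 0 , z≤n , done s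

  dist-rotation : Rotation T U → Dist≤ T U 1
  dist-rotation ρ = 1 , ≤-refl , next ρ (done same-refl)

  module _ {r∈S : r ∈ S} {ac : IsComponent (S - r) K} {uK : K ∪ ⊥ ≡ S - r} where

    private
      lift : SearchTree K → SearchTree S
      lift = single r∈S ac uK

      tube≢ : ∀ {Z} (T : SearchTree K) → IsTube T Z → Z ≢ S
      tube≢ T t refl = x∉p-x (proj₁ ac (tube⊆ T t r∈S))

      lift-symDiff : ∀ {T U : SearchTree K} {Z} → InSymDiff T U Z → InSymDiff (lift T) (lift U) Z
      lift-symDiff {T} {U} (inj₁ (t , ¬u)) = inj₁ (there (here t) , [ tube≢ T t , ¬u ]′ ∘ single-tube⁻)
      lift-symDiff {T} {U} (inj₂ (¬t , u)) = inj₂ ([ tube≢ U u , ¬t ]′ ∘ single-tube⁻ , there (here u))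

      unlift-symDiff : ∀ {T U : SearchTree K} {Z} → InSymDiff (lift T) (lift U) Z → InSymDiff T U Z
      unlift-symDiff (inj₁ (t , ¬u)) with single-tube⁻ t
      ... | inj₁ refl = ⊥-elim (¬u here)
      ... | inj₂ t' = inj₁ (t' , λ t'' → ¬u (there (here t'')))
      unlift-symDiff (inj₂ (¬t , u)) with single-tube⁻ u
      ... | inj₁ refl = ⊥-elim (¬t here)
      ... | inj₂ u' = inj₂ ((λ t'' → ¬t (there (here t''))) , u')

      lift-rotation : ∀ {T U : SearchTree K} → Rotation T U → Rotation (lift T) (lift U)
      lift-rotation (X , Y , X≢Y , dX , dY , only) =
        X , Y , X≢Y , lift-symDiff dX , lift-symDiff dY , λ Z → only Z ∘ unlift-symDiff

      lift-same : ∀ {T U : SearchTree K} → SameTree T U → SameTree (lift T) (lift U)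
      lift-same s X = move (proj₁ (s X)) , move (proj₂ (s X))
        where
        move : ∀ {T U} → (IsTube T X → IsTube U X) → IsTube (lift T) X → IsTube (lift U) X
        move f t with single-tube⁻ t
        ... | inj₁ refl = here
        ... | inj₂ t' = there (here (f t'))

      lift-path : ∀ {T U : SearchTree K} → RotPath T U k → RotPath (lift T) (lift U) k
      lift-path (done s) = done (lift-same s)
      lift-path (next ρ π) = next (lift-rotation ρ) (lift-path π)

    single-dist : ∀ {T U : SearchTree K} → Dist≤ T U k → Dist≤ (single r∈S ac uK T) (single r∈S ac uK U) k
    single-dist (j , j≤k , π) = j , j≤k , lift-path π

  module RootExchange {S K : Subset n} {u v : Fin n} (u∈S : u ∈ S) (v∈S : v ∈ S)
    (ac : IsComponent (S - u) K) (uK : K ∪ ⊥ ≡ S - u) (v∈K : v ∈ K)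
    (ch : Children) (a : AreComponents (K - v) ch) (ap : Distinct ch) (un : ⋃L (map proj₁ ch) ≡ K - v)
    (cv : IsComponent (S - v) (S - v)) (u∈S-v : u ∈ S - v)
    (a' : AreComponents (S - v - u) ch) (un' : ⋃L (map proj₁ ch) ≡ S - v - u) where

    before after : SearchTree S
    before = single u∈S ac uK (node v v∈K ch a ap un)
    after = single v∈S cv (∪-identityʳ (S - v)) (node u u∈S-v ch a' ap un')

    private
      u∉K : u ∉ K
      u∉K = x∉p-x ∘ proj₁ ac

      K≢S-v : K ≢ S - v
      K≢S-v K≡S-v = u∉K (subst (u ∈_) (sym K≡S-v) u∈S-v)

      ¬after-K : ¬ IsTube after K
      ¬after-K t with single-tube⁻ t
      ... | inj₁ K≡S = u∉K (subst (u ∈_) (sym K≡S) u∈S)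
      ... | inj₂ t' with node-tube⁻ t'
      ... | inj₁ K≡S-v = K≢S-v K≡S-v
      ... | inj₂ t'' = x∉p-x (x∈p-y⇒x∈p (anyTube⊆ ch a' t'' v∈K))

      ¬before-S-v : ¬ IsTube before (S - v)
      ¬before-S-v t with single-tube⁻ t
      ... | inj₁ S-v≡S = x∉p-x (subst (v ∈_) (sym S-v≡S) v∈S)
      ... | inj₂ t' with node-tube⁻ t'
      ... | inj₁ S-v≡K = K≢S-v (sym S-v≡K)
      ... | inj₂ t'' = u∉K (x∈p-y⇒x∈p (anyTube⊆ ch a t'' u∈S-v))

      from-before : ∀ {Z} → IsTube before Z → Z ≡ K ⊎ IsTube after Z
      from-before t with single-tube⁻ t
      ... | inj₁ refl = inj₂ here
      ... | inj₂ t' with node-tube⁻ t'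
      ... | inj₁ Z≡K = inj₁ Z≡K
      ... | inj₂ t'' = inj₂ (there (here (there t'')))

      from-after : ∀ {Z} → IsTube after Z → Z ≡ S - v ⊎ IsTube before Z
      from-after t with single-tube⁻ t
      ... | inj₁ refl = inj₂ here
      ... | inj₂ t' with node-tube⁻ t'
      ... | inj₁ Z≡S-v = inj₁ Z≡S-v
      ... | inj₂ t'' = inj₂ (there (here (there t'')))

    rotation : Rotation before after
    rotation = rotation-by-exchange K (S - v) K≢S-v (there (here here)) ¬after-K
                 (there (here here)) ¬before-S-v from-before from-after

module CompleteSplit (p q : ℕ) where

  open GraphDefs (SPK-Adj p q)
  open SearchTreeProperties (SPK-Adj p q)

  private
    V = Fin (p + q)
    Sub = Subset (p + q)
    variable
      R S K : Sub
      r u v w x : V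

  IsP : V → Set
  IsP = InP {p} {q}

  HasP : Sub → Set
  HasP S = ∃ λ v → v ∈ S × IsP v

  NoP : Sub → Set
  NoP S = ∀ {v} → v ∈ S → ¬ IsP v

  isP? : (v : V) → Dec (IsP v)
  isP? v = toℕ v <? p

  hasP? : (S : Sub) → Dec (HasP S)
  hasP? S = any? (λ v → (v ∈? S) ×-dec isP? v)

  ¬hasP⇒noP : ¬ HasP S → NoP S
  ¬hasP⇒noP ¬h v∈S vP = ¬h (_ , v∈S , vP)

  hasP-⊆ : R ⊆ S → HasP R → HasP S
  hasP-⊆ R⊆S (w , w∈R , wP) = w , R⊆S w∈R , wP

  hasP⇒nonempty : HasP S → Nonempty S
  hasP⇒nonempty (w , w∈S , _) = w , w∈S

  hasP⇒connected : HasP S → Connected S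
  hasP⇒connected {S} (w , w∈S , wP) u v u∈S v∈S = walk-++ (to-w u∈S) (from-w v∈S)
    where
    to-w : ∀ {t} → t ∈ S → Walk S t w
    to-w {t} t∈S with t ≟ w
    ... | yes refl = stay w∈S
    ... | no t≢w = step t∈S (t≢w , inj₂ wP) (stay w∈S)
    from-w : ∀ {t} → t ∈ S → Walk S w t
    from-w {t} t∈S with w ≟ t
    ... | yes refl = stay w∈S
    ... | no w≢t = step w∈S (w≢t , inj₁ wP) (stay t∈S)

  hasP⇒component : HasP S → IsComponent S S
  hasP⇒component h = connected⇒component (hasP⇒nonempty h) (hasP⇒connected h)

  hasP⇒sole-child : HasP R → (ch : Children) (a : AreComponents R ch) (ap : Distinct ch) →
                    ⋃L (map proj₁ ch) ≡ R → SoleChild R ch a ap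
  hasP⇒sole-child h = sole-child (hasP⇒nonempty h) (hasP⇒connected h)

  noP⇒¬edge : NoP S → u ∈ S → v ∈ S → ¬ SPK-Adj p q u v
  noP⇒¬edge noP u∈S _ (_ , inj₁ uP) = noP u∈S uP
  noP⇒¬edge noP _ v∈S (_ , inj₂ vP) = noP v∈S vP

  noP⇒walk-trivial : NoP S → Walk S u v → u ≡ v
  noP⇒walk-trivial noP (stay _) = refl
  noP⇒walk-trivial noP (step u∈S e w) = ⊥-elim (noP⇒¬edge noP u∈S (walk-source∈ w) e)

  #P #Q : Sub → ℕ
  #P S = ∣ S ∩ initial p ∣
  #Q S = ∣ S ∩ ∁ (initial p) ∣

  #P-remove-P : ∀ {S x} → x ∈ S → IsP x → #P S ≡ suc (#P (S - x))
  #P-remove-P {S} x∈S xP = ∣p∩q∣≡1+∣p-x∩q∣ S _ x∈S (x∈initial⁺ p xP)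

  #Q-remove-P : ∀ {S x} → IsP x → #Q S ≡ #Q (S - x)
  #Q-remove-P {S} xP = ∣p∩q∣≡∣p-x∩q∣ S _ (x∈p⇒x∉∁p (x∈initial⁺ p xP))

  #P-remove-Q : ∀ {S x} → ¬ IsP x → #P S ≡ #P (S - x)
  #P-remove-Q {S} ¬xP = ∣p∩q∣≡∣p-x∩q∣ S _ (¬xP ∘ x∈initial⁻ p)

  #Q-remove-Q : ∀ {S x} → x ∈ S → ¬ IsP x → #Q S ≡ suc (#Q (S - x))
  #Q-remove-Q {S} x∈S ¬xP = ∣p∩q∣≡1+∣p-x∩q∣ S _ x∈S (x∉p⇒x∈∁p (¬xP ∘ x∈initial⁻ p))

  #P⊤≡p : #P ⊤ ≡ p
  #P⊤≡p = trans (cong ∣_∣ (∩-identityˡ (initial p))) (∣initial∣≡ p)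

  #Q⊤≡q : #Q ⊤ ≡ q
  #Q⊤≡q = begin
    ∣ ⊤ ∩ ∁ (initial p) ∣   ≡⟨ cong ∣_∣ (∩-identityˡ (∁ (initial p))) ⟩
    ∣ ∁ (initial p) ∣        ≡⟨ ∣∁p∣≡n∸∣p∣ (initial p) ⟩
    p + q ∸ ∣ initial p ∣    ≡⟨ cong (p + q ∸_) (∣initial∣≡ p) ⟩
    p + q ∸ p                ≡⟨ m+n∸m≡n p q ⟩
    q                        ∎
    where open ≡-Reasoning

  #P*#Q-remove-P : ∀ {S x} → x ∈ S → IsP x → #P (S - x) * #Q (S - x) ≤ #P S * #Q S
  #P*#Q-remove-P {S} {x} x∈S xP = begin
    #P (S - x) * #Q (S - x)        ≤⟨ *-monoˡ-≤ (#Q (S - x)) (n≤1+n (#P (S - x))) ⟩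
    suc (#P (S - x)) * #Q (S - x)  ≡⟨ sym (cong₂ _*_ (#P-remove-P x∈S xP) (#Q-remove-P {S} {x} xP)) ⟩
    #P S * #Q S                    ∎
    where open ≤-Reasoning

  #P*#Q-remove-Q : ∀ {S x} → x ∈ S → ¬ IsP x → #P (S - x) * #Q (S - x) + #P (S - x) ≡ #P S * #Q S
  #P*#Q-remove-Q {S} {x} x∈S ¬xP = begin
    #P (S - x) * #Q (S - x) + #P (S - x)  ≡⟨ +-comm (#P (S - x) * #Q (S - x)) (#P (S - x)) ⟩
    #P (S - x) + #P (S - x) * #Q (S - x)  ≡⟨ sym (*-suc (#P (S - x)) (#Q (S - x))) ⟩
    #P (S - x) * suc (#Q (S - x))         ≡⟨ sym (cong₂ _*_ (#P-remove-Q {S} {x} ¬xP) (#Q-remove-Q x∈S ¬xP)) ⟩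
    #P S * #Q S                           ∎
    where open ≡-Reasoning

  #P-C2-remove-P : ∀ {S x} → x ∈ S → IsP x → #P (S - x) + #P (S - x) C 2 ≡ #P S C 2
  #P-C2-remove-P {S} {x} x∈S xP =
    trans (n+nC2≡[1+n]C2 (#P (S - x))) (cong (_C 2) (sym (#P-remove-P x∈S xP)))

  mutual
    Standard : SearchTree S → Set
    Standard {S} (node r _ ch _ _ _) = (HasP S → IsP r) × AllStandard ch

    AllStandard : Children → Set
    AllStandard [] = Unit
    AllStandard ((_ , T) ∷ ch) = Standard T × AllStandard ch

  mutual
    noP⇒standard : NoP S → (T : SearchTree S) → Standard T
    noP⇒standard noP (node r r∈S ch a ap u) =
      (λ (w , w∈S , wP) → ⊥-elim (noP w∈S wP)) , noP⇒allStandard (noP ∘ x∈p-y⇒x∈p) ch a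

    noP⇒allStandard : NoP R → (ch : Children) → AreComponents R ch → AllStandard ch
    noP⇒allStandard noP [] [] = tt
    noP⇒allStandard noP ((K , T) ∷ ch) (ac ∷ a) =
      noP⇒standard (noP ∘ proj₁ ac) T , noP⇒allStandard noP ch a

  data HasRoot : SearchTree S → V → Set where
    root : ∀ {r r∈S ch a ap u} → HasRoot (node {S} r r∈S ch a ap u) r

  -- Rotating an independent root r below its clique child x, whose other descendants are all
  -- independent, turns r into a leaf of x.
  module LeafExchange (r∈S : r ∈ S) (¬rP : ¬ IsP r)
    (ac : IsComponent (S - r) K) (uK : K ∪ ⊥ ≡ S - r) (x∈K : x ∈ K) (xP : IsP x)
    (ch : Children) (a : AreComponents (K - x) ch) (ap : Distinct ch) (un : ⋃L (map proj₁ ch) ≡ K - x)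
    (noP : NoP (K - x)) where

    private
      K≡S-r : K ≡ S - r
      K≡S-r = sole-child≡ uK

      x∈S : x ∈ S
      x∈S = x∈p-y⇒x∈p (proj₁ ac x∈K)

      x≢r : x ≢ r
      x≢r = x∈p-y⇒x≢y (proj₁ ac x∈K)

      r∉K : r ∉ K
      r∉K = x∉p-x ∘ proj₁ ac

      r∈S-x : r ∈ S - x
      r∈S-x = x∈p∧x≢y⇒x∈p-y r∈S (x≢r ∘ sym)

      K-x⊆S-x : K - x ⊆ S - x
      K-x⊆S-x v∈K-x = x∈p∧x≢y⇒x∈p-y (x∈p-y⇒x∈p (proj₁ ac (x∈p-y⇒x∈p v∈K-x))) (x∈p-y⇒x≢y v∈K-x)

      S-x⊆r∪K-x : ∀ {v} → v ∈ S - x → v ≡ r ⊎ v ∈ K - x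
      S-x⊆r∪K-x {v} v∈S-x with v ≟ r
      ... | yes v≡r = inj₁ v≡r
      ... | no v≢r = inj₂ (x∈p∧x≢y⇒x∈p-y
              (subst (v ∈_) (sym K≡S-r) (x∈p∧x≢y⇒x∈p-y (x∈p-y⇒x∈p v∈S-x) v≢r)) (x∈p-y⇒x≢y v∈S-x))

      noP-S-x : NoP (S - x)
      noP-S-x v∈S-x with S-x⊆r∪K-x v∈S-x
      ... | inj₁ refl = ¬rP
      ... | inj₂ v∈K-x = noP v∈K-x

      ⁅r⁆⊆S-x : ⁅ r ⁆ ⊆ S - x
      ⁅r⁆⊆S-x v∈⁅r⁆ = subst (_∈ S - x) (sym (x∈⁅y⁆⇒x≡y r v∈⁅r⁆)) r∈S-x

      leaf : SearchTree ⁅ r ⁆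
      leaf = node r (x∈⁅x⁆ r) [] [] []
        (⊆-antisym (⊥-elim ∘ ∉⊥) (λ v∈ → ⊥-elim (x∈p-y⇒x≢y v∈ (x∈⁅y⁆⇒x≡y r (x∈p-y⇒x∈p v∈)))))

      ⁅r⁆-component : IsComponent (S - x) ⁅ r ⁆
      ⁅r⁆-component = ⁅r⁆⊆S-x , (r , x∈⁅x⁆ r) ,
        (λ u v u∈ v∈ → subst₂ (Walk ⁅ r ⁆) (sym (x∈⁅y⁆⇒x≡y r u∈)) (sym (x∈⁅y⁆⇒x≡y r v∈)) (stay (x∈⁅x⁆ r))) ,
        (λ u v u∈ v∈ e → ⊥-elim (noP⇒¬edge noP-S-x (⁅r⁆⊆S-x u∈) v∈ e))

      widen : ∀ {D} → IsComponent (K - x) D → IsComponent (S - x) D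
      widen (D⊆ , ne , conn , _) =
        K-x⊆S-x ∘ D⊆ , ne , conn , λ u v u∈ v∈ e → ⊥-elim (noP⇒¬edge noP-S-x (K-x⊆S-x (D⊆ u∈)) v∈ e)

      ch' : Children
      ch' = (⁅ r ⁆ , leaf) ∷ ch

      a' : AreComponents (S - x) ch'
      a' = ⁅r⁆-component ∷ All.map widen a

      ap' : Distinct ch'
      ap' = All.map (λ ad ⁅r⁆≡D → r∉K (x∈p-y⇒x∈p (proj₁ ad (subst (r ∈_) ⁅r⁆≡D (x∈⁅x⁆ r))))) a ∷ ap

      un' : ⋃L (map proj₁ ch') ≡ S - x
      un' = trans (cong (⁅ r ⁆ ∪_) un) (⊆-antisym
        ([ ⁅r⁆⊆S-x , K-x⊆S-x ]′ ∘ x∈p∪q⁻ ⁅ r ⁆ (K - x))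
        (λ v∈S-x → x∈p∪q⁺ ([ (λ { refl → inj₁ (x∈⁅x⁆ r) }) , inj₂ ]′ (S-x⊆r∪K-x v∈S-x))))

    before after : SearchTree S
    before = single r∈S ac uK (node x x∈K ch a ap un)
    after = node x x∈S ch' a' ap' un'

    private
      K≢⁅r⁆ : K ≢ ⁅ r ⁆
      K≢⁅r⁆ K≡⁅r⁆ = r∉K (subst (r ∈_) (sym K≡⁅r⁆) (x∈⁅x⁆ r))

      ¬after-K : ¬ IsTube after K
      ¬after-K t with node-tube⁻ t
      ... | inj₁ K≡S = r∉K (subst (r ∈_) (sym K≡S) r∈S)
      ... | inj₂ (here t') = x≢r (x∈⁅y⁆⇒x≡y r (tube⊆ leaf t' x∈K))
      ... | inj₂ (there t') = x∉p-x (anyTube⊆ ch a t' x∈K)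

      ¬before-⁅r⁆ : ¬ IsTube before ⁅ r ⁆
      ¬before-⁅r⁆ t with single-tube⁻ t
      ... | inj₁ ⁅r⁆≡S = x≢r (x∈⁅y⁆⇒x≡y r (subst (x ∈_) (sym ⁅r⁆≡S) x∈S))
      ... | inj₂ t' = r∉K (tube⊆ (node x x∈K ch a ap un) t' (x∈⁅x⁆ r))

      from-before : ∀ {Z} → IsTube before Z → Z ≡ K ⊎ IsTube after Z
      from-before t with single-tube⁻ t
      ... | inj₁ refl = inj₂ here
      ... | inj₂ t' with node-tube⁻ t'
      ... | inj₁ Z≡K = inj₁ Z≡K
      ... | inj₂ t'' = inj₂ (there (there t''))

      from-after : ∀ {Z} → IsTube after Z → Z ≡ ⁅ r ⁆ ⊎ IsTube before Z
      from-after t with node-tube⁻ t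
      ... | inj₁ refl = inj₂ here
      ... | inj₂ (there t') = inj₂ (there (here (there t')))
      ... | inj₂ (here t') with node-tube⁻ t'
      ... | inj₁ Z≡⁅r⁆ = inj₁ Z≡⁅r⁆
      ... | inj₂ ()

    rotation : Rotation before after
    rotation = rotation-by-exchange K ⁅ r ⁆ K≢⁅r⁆ (there (here here)) ¬after-K
                 (there (here here)) ¬before-⁅r⁆ from-before from-after

    after-standard : Standard after
    after-standard = (λ _ → xP) , noP⇒standard (λ v∈ → subst (¬_ ∘ IsP) (sym (x∈⁅y⁆⇒x≡y r v∈)) ¬rP) leaf ,
                     noP⇒allStandard noP ch a

  noP-connected⇒singleton : ∀ {D Z} → NoP D → Connected D → Z ⊆ D → w ∈ Z → Z ≡ ⁅ w ⁆
  noP-connected⇒singleton {w} noP conn Z⊆D w∈Z = ⊆-antisym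
    (λ z∈Z → subst (_∈ ⁅ w ⁆) (noP⇒walk-trivial noP (conn _ _ (Z⊆D w∈Z) (Z⊆D z∈Z))) (x∈⁅x⁆ w))
    (λ z∈⁅w⁆ → subst (_∈ _) (sym (x∈⁅y⁆⇒x≡y w z∈⁅w⁆)) w∈Z)

  noP-anyTube⁻ : ∀ {Z} → NoP R → (ch : Children) → AreComponents R ch → AnyTube ch Z →
                 ∃ λ v → v ∈ R × Z ≡ ⁅ v ⁆
  noP-anyTube⁻ noP ((D , T) ∷ ch) (ad ∷ a) (here t) with tube-nonempty T t
  ... | w , w∈Z = w , proj₁ ad (tube⊆ T t w∈Z) ,
                  noP-connected⇒singleton (noP ∘ proj₁ ad) (proj₁ (proj₂ (proj₂ ad))) (tube⊆ T t) w∈Z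
  noP-anyTube⁻ noP (_ ∷ ch) (_ ∷ a) (there t) = noP-anyTube⁻ noP ch a t

  noP-anyTube⁺ : NoP R → (ch : Children) → AreComponents R ch → v ∈ ⋃L (map proj₁ ch) → AnyTube ch ⁅ v ⁆
  noP-anyTube⁺ noP [] [] v∈⊥ = ⊥-elim (∉⊥ v∈⊥)
  noP-anyTube⁺ noP ((D , T) ∷ ch) (ad ∷ a) v∈ with x∈p∪q⁻ D _ v∈
  ... | inj₁ v∈D = here (subst (IsTube T)
          (noP-connected⇒singleton (noP ∘ proj₁ ad) (proj₁ (proj₂ (proj₂ ad))) id v∈D) (tube-self T))
  ... | inj₂ v∈rest = there (noP-anyTube⁺ noP ch a v∈rest)

  -- Without clique vertices below the root every subtree is a leaf, so the tubes are determined.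
  noP-children⇒same : ∀ {x∈S x∈S' ch a ap u ch' a' ap' u'} → NoP (S - x) →
                      SameTree (node {S} x x∈S ch a ap u) (node {S} x x∈S' ch' a' ap' u')
  noP-children⇒same {S} {x} {ch = ch} {a} {u = u} {ch'} {a'} {u' = u'} noP X =
    move ch a ch' a' u' , move ch' a' ch a u
    where
    move : ∀ {y∈S y∈S'} ch a ch' a' {ap ap' u} u' →
           IsTube (node {S} x y∈S ch a ap u) X → IsTube (node {S} x y∈S' ch' a' ap' u') X
    move ch a ch' a' u' t with node-tube⁻ t
    ... | inj₁ refl = here
    ... | inj₂ t' with noP-anyTube⁻ noP ch a t'
    ... | v , v∈S-x , refl = there (noP-anyTube⁺ noP ch' a' (subst (v ∈_) (sym u') v∈S-x))

  sink : ∀ {S r K} (r∈S : r ∈ S) (ac : IsComponent (S - r) K) (uK : K ∪ ⊥ ≡ S - r) (T : SearchTree K) →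
         ¬ IsP r → Standard T → HasP K →
         Σ (SearchTree S) λ T' → Standard T' × Dist≤ (single r∈S ac uK T) T' (#P K)
  sink {S} {r} {K} r∈S ac uK (node x x∈K ch a ap un) ¬rP (root-P , ch-std) hK with hasP? (K - x)
  ... | no ¬h = after , after-standard , dist-mono one≤#P (dist-rotation rotation)
    where
    open LeafExchange r∈S ¬rP ac uK x∈K (root-P hK) ch a ap un (¬hasP⇒noP ¬h)
    one≤#P : 1 ≤ #P K
    one≤#P = subst (1 ≤_) (sym (#P-remove-P x∈K (root-P hK))) (s≤s z≤n)
  ... | yes h with hasP⇒sole-child h ch a ap un
  ... | sole {T₂} {ad} =
    let T' , T'-std , d = sink r∈S-x ad' un' T₂ ¬rP (proj₁ ch-std) h
    in single x∈S cv (∪-identityʳ (S - x)) T' , ((λ _ → xP) , T'-std , tt) ,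
       dist-mono bound (dist-trans (dist-rotation rotation) (single-dist d))
    where
    xP : IsP x
    xP = root-P hK
    x∈S : x ∈ S
    x∈S = x∈p-y⇒x∈p (proj₁ ac x∈K)
    r∈S-x : r ∈ S - x
    r∈S-x = x∈p∧x≢y⇒x∈p-y r∈S (x∈p-y⇒x≢y (proj₁ ac x∈K) ∘ sym)
    swap≡ : K - x ≡ S - x - r
    swap≡ = trans (cong (_- x) (sole-child≡ uK)) (p─x─y≡p─y─x S r x)
    cv : IsComponent (S - x) (S - x)
    cv = hasP⇒component (hasP-⊆ (λ v∈ → x∈p-y⇒x∈p (subst (_ ∈_) swap≡ v∈)) h)
    ad' : IsComponent (S - x - r) (K - x)
    ad' = subst (λ R → IsComponent R (K - x)) swap≡ ad
    un' : (K - x) ∪ ⊥ ≡ S - x - r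
    un' = trans un swap≡
    open RootExchange r∈S x∈S ac uK x∈K _ (ad ∷ []) ([] ∷ []) un cv r∈S-x (ad' ∷ []) un'
    bound : 1 + #P (K - x) ≤ #P K
    bound = ≤-reflexive (sym (#P-remove-P x∈K xP))

  standardize : (T : SearchTree S) → Σ (SearchTree S) λ T' → Standard T' × Dist≤ T T' (#P S * #Q S)
  standardize {S} (node r r∈S ch a ap u) with hasP? (S - r)
  ... | no ¬h = node r r∈S ch a ap u , (root-P , noP⇒allStandard (¬hasP⇒noP ¬h) ch a) , dist-same same-refl
    where
    root-P : HasP S → IsP r
    root-P (w , w∈S , wP) with w ≟ r
    ... | yes refl = wP
    ... | no w≢r = ⊥-elim (¬h (w , x∈p∧x≢y⇒x∈p-y w∈S w≢r , wP))
  ... | yes h with hasP⇒sole-child h ch a ap u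
  ... | sole {T₁} {ac} with standardize T₁ | isP? r
  ... | T₁' , T₁'-std , d | yes rP =
    single r∈S ac u T₁' , ((λ _ → rP) , T₁'-std , tt) , dist-mono (#P*#Q-remove-P r∈S rP) (single-dist d)
  ... | T₁' , T₁'-std , d | no ¬rP with sink r∈S ac u T₁' ¬rP T₁'-std h
  ... | T' , T'-std , d' =
    T' , T'-std , dist-mono (≤-reflexive (#P*#Q-remove-Q r∈S ¬rP)) (dist-trans (single-dist d) d')

  raise : (T : SearchTree S) → Standard T → x ∈ S → IsP x →
          Σ (SearchTree S) λ T' → Standard T' × HasRoot T' x × Dist≤ T T' (#P (S - x))
  raise {S} {x} (node y y∈S ch a ap u) (root-P , ch-std) x∈S xP with y ≟ x
  ... | yes refl = node y y∈S ch a ap u , (root-P , ch-std) , root , dist-same same-refl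
  ... | no y≢x with hasP⇒sole-child (x , x∈p∧x≢y⇒x∈p-y x∈S (y≢x ∘ sym) , xP) ch a ap u
  ... | sole {T₁} {ac} with raise T₁ (proj₁ ch-std) (x∈p∧x≢y⇒x∈p-y x∈S (y≢x ∘ sym)) xP
  ... | node .x x∈S-y ch₁ a₁ ap₁ u₁ , (_ , ch₁-std) , root , d =
    after , ((λ _ → xP) , ((λ _ → yP) , ch₁-std) , tt) , root ,
    dist-mono bound (dist-trans (single-dist d) (dist-rotation rotation))
    where
    yP : IsP y
    yP = root-P (x , x∈S , xP)
    y∈S-x : y ∈ S - x
    y∈S-x = x∈p∧x≢y⇒x∈p-y y∈S y≢x
    swap≡ : S - y - x ≡ S - x - y
    swap≡ = p─x─y≡p─y─x S y x
    open RootExchange y∈S x∈S ac u x∈S-y ch₁ a₁ ap₁ u₁ (hasP⇒component (y , y∈S-x , yP)) y∈S-x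
      (subst (λ R → AreComponents R ch₁) swap≡ a₁) (trans u₁ swap≡)
    bound : #P (S - y - x) + 1 ≤ #P (S - x)
    bound = ≤-reflexive (begin
      #P (S - y - x) + 1   ≡⟨ +-comm (#P (S - y - x)) 1 ⟩
      suc (#P (S - y - x)) ≡⟨ cong (suc ∘ #P) swap≡ ⟩
      suc (#P (S - x - y)) ≡⟨ sym (#P-remove-P y∈S-x yP) ⟩
      #P (S - x)           ∎)
      where open ≡-Reasoning

  mutual
    standard-dist : (T U : SearchTree S) → Standard T → Standard U → HasP S → Dist≤ T U (#P S C 2)
    standard-dist T U@(node x x∈S _ _ _ _) T-std U-std@(root-P , _) hS =
      let T' , T'-std , T'-root , d = raise T T-std x∈S (root-P hS)
      in dist-mono (≤-reflexive (#P-C2-remove-P x∈S (root-P hS)))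
           (dist-trans d (same-root-dist T' U T'-root root T'-std U-std))

    same-root-dist : (T U : SearchTree S) → HasRoot T x → HasRoot U x → Standard T → Standard U →
                     Dist≤ T U (#P (S - x) C 2)
    same-root-dist {S} {x} (node x _ ch a ap u) (node x _ ch' a' ap' u') root root (_ , std) (_ , std')
      with hasP? (S - x)
    ... | no ¬h = dist-same (noP-children⇒same (¬hasP⇒noP ¬h))
    ... | yes h with hasP⇒sole-child h ch a ap u | hasP⇒sole-child h ch' a' ap' u'
    ... | sole {T₁} | sole {U₁} =
      dist-congʳ (single-dist (standard-dist T₁ U₁ (proj₁ std) (proj₁ std') h)) single-same

  rotation-diameter : 1 ≤ p → DiameterAtMost (2 * p * q + p C 2)
  rotation-diameter 1≤p T U with standardize T | standardize U
  ... | T' , T'-std , dT | U' , U'-std , dU =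
    dist-mono (≤-reflexive total)
      (dist-trans dT (dist-trans (standard-dist T' U' T'-std U'-std hasP-⊤) (dist-sym dU)))
    where
    hasP-⊤ : HasP ⊤
    hasP-⊤ = fromℕ< (≤-trans 1≤p (m≤m+n p q)) , ∈⊤ , subst (_< p) (sym (toℕ-fromℕ< _)) 1≤p
    total : #P ⊤ * #Q ⊤ + (#P ⊤ C 2 + #P ⊤ * #Q ⊤) ≡ 2 * p * q + p C 2
    total = begin
      #P ⊤ * #Q ⊤ + (#P ⊤ C 2 + #P ⊤ * #Q ⊤)  ≡⟨ cong₂ (λ m n → m * n + (m C 2 + m * n)) #P⊤≡p #Q⊤≡q ⟩
      p * q + (p C 2 + p * q)                  ≡⟨ cong (p * q +_) (+-comm (p C 2) (p * q)) ⟩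
      p * q + (p * q + p C 2)                  ≡⟨ sym (+-assoc (p * q) (p * q) (p C 2)) ⟩
      p * q + p * q + p C 2                    ≡⟨ cong (λ n → p * q + n + p C 2) (sym (+-identityʳ (p * q))) ⟩
      2 * (p * q) + p C 2                      ≡⟨ cong (_+ p C 2) (sym (*-assoc 2 p q)) ⟩
      2 * p * q + p C 2                        ∎
      where open ≡-Reasoning

lemma24 : (p q : ℕ) → 1 ≤ p → 1 ≤ q →
    GraphDefs.DiameterAtMost (SPK-Adj p q) (2 * p * q + p C 2)
lemma24 p q 1≤p _ = CompleteSplit.rotation-diameter p q 1≤p
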